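{- Let $k\ge 0$ be an integer. If $G$ is a graph with $k+3$ vertices that has a $(k,2)$-edge co-colouring, then $G$ has an independent set of size 2.
   Context: Graphs are finite and simple. A $(k,p)$-edge co-colouring of a graph $G$ is an assignment of one of $k$ colours to each edge of $G$ such that no $p$ pairwise disjoint edges (edges whose endpoint sets are pairwise disjoint) all receive the same colour. -}

module Defs where

open import Data.Nat using (ℕ)
open import Data.Fin using (Fin)
open import Data.Bool using (Bool; true; false)
open import Data.Product using (Σ; ∃; _×_; _,_)
open import Relation.Binary.PropositionalEquality using (_≡_; _≢_)
open import Relation.Nullary using (¬_)

record Graph (n : ℕ) : Set where
  field
    adj     : Fin n → Fin n → Bool
    sym     : ∀ u v → adj u v ≡ adj v u
    irrefl  : ∀ u → adj u u ≡ false

open Graph public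

Edge : {n : ℕ} → Graph n → Fin n → Fin n → Set
Edge G u v = adj G u v ≡ true

Disjoint : {n : ℕ} → Fin n → Fin n → Fin n → Fin n → Set
Disjoint a b c d = a ≢ c × a ≢ d × b ≢ c × b ≢ d

-- An assignment of one of k colours to each edge of G. Edges are unordered,
-- so a colouring is a function on vertex pairs which is symmetric on edges
-- (its values on non-edges are irrelevant).
record EdgeColouring {n : ℕ} (k : ℕ) (G : Graph n) : Set where
  field
    colour : Fin n → Fin n → Fin k
    colour-sym : ∀ u v → Edge G u v → colour u v ≡ colour v u

open EdgeColouring public

IsCoColouring2 : {n k : ℕ} (G : Graph n) → EdgeColouring k G → Set
IsCoColouring2 G c =
  ∀ a b x y → Edge G a b → Edge G x y → Disjoint a b x y →
    colour c a b ≢ colour c x y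

HasCoColouring2 : {n : ℕ} → ℕ → Graph n → Set
HasCoColouring2 k G = Σ (EdgeColouring k G) (IsCoColouring2 G)

HasIndependentPair : {n : ℕ} → Graph n → Set
HasIndependentPair {n} G = Σ (Fin n) λ u → Σ (Fin n) λ v → u ≢ v × ¬ Edge G u v

{-# OPTIONS --safe #-}
module Submission where

open import Defs hiding (sym)
open import Data.Nat using (ℕ; zero; suc; _+_; _*_; _≤_; _<_; s≤s; z<s)
open import Data.Nat.Properties
  using (_<?_; ≮⇒≥; ≤∧≢⇒<; m<1+n⇒m≤n; n<1+n; m<n⇒m<1+n; <-≤-trans; +-monoˡ-≤; +-cancelˡ-<;
         *-suc; +-suc; +-comm; m<n+m; module ≤-Reasoning)
import Data.Nat.Properties as ℕ
open import Data.Nat.Tactic.RingSolver using (solve-∀)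
open import Data.Fin using (Fin; zero; suc; toℕ; fromℕ<; punchIn; punchOut)
open import Data.Fin.Properties
  using (_≟_; any?; ¬Fin0; suc-injective; toℕ-injective; toℕ<n; toℕ-fromℕ<;
         punchIn-injective; punchInᵢ≢i; punchOut-injective; punchOut-cong)
open import Data.Bool using (true)
import Data.Bool.Properties as Bool
open import Data.Empty using (⊥; ⊥-elim)
open import Data.Product using (∃₂; ∃-syntax; _×_; _,_; proj₁; proj₂)
open import Data.Sum using (_⊎_; inj₁; inj₂)
open import Data.List using (List; []; _∷_; _++_; length; filter; tabulate)
open import Data.List.Properties using (length-++; length-tabulate)
open import Data.List.Relation.Unary.All as All using (All; _∷_)
import Data.List.Relation.Unary.All.Properties as All
open import Data.List.Relation.Unary.AllPairs using (AllPairs; _∷_)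
import Data.List.Relation.Unary.AllPairs.Properties as AllPairs
open import Data.List.Relation.Binary.Sublist.Propositional.Properties
  using (filter-⊆; filter⁺; length-mono-≤)
open import Relation.Nullary using (¬_; yes; no; ¬?)
open import Relation.Nullary.Decidable using (_×-dec_; decidable-stable)
open import Relation.Unary using (Decidable)
open import Relation.Binary.PropositionalEquality
open import Function using (_∘_)

-- If G has two non-adjacent vertices we are done, so let G be the complete graph
-- K_{k+3}. Each colour class is then a pairwise intersecting family of edges, and
-- such a family with four edges is a star: two of the other three edges meet the
-- first at the same endpoint w, and an edge avoiding w cannot meet three edges at
-- w with distinct other ends. By pigeonhole, the 3k+3 edges meeting three fixed
-- vertices contain four of one colour, hence some colour class is a star. Deleting
-- its centre leaves K_{k+2} co-coloured with k-1 colours, and induction on k ends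
-- at K_3, which has an edge but no colour for it.

module _ {A : Set} {P : A → Set} (P? : Decidable P) where

  length-filter+filter-¬ : ∀ xs → length xs ≡ length (filter P? xs) + length (filter (¬? ∘ P?) xs)
  length-filter+filter-¬ []       = refl
  length-filter+filter-¬ (x ∷ xs) with P? x
  ... | yes _ = cong suc (length-filter+filter-¬ xs)
  ... | no  _ = trans (cong suc (length-filter+filter-¬ xs)) (sym (+-suc _ _))

module _ {A : Set} (col : A → ℕ) where

  fibre : ℕ → List A → List A
  fibre a = filter (λ x → col x ℕ.≟ a)

  pigeonhole : ∀ k m (xs : List A) → All (λ x → col x < m) xs → k * m < length xs →
               ∃[ a ] a < m × k < length (fibre a xs)
  pigeonhole k zero    (x ∷ xs) (() ∷ _) _
  pigeonhole k (suc m) xs bounded long with k <? length (fibre m xs)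
  ... | yes large = m , n<1+n m , large
  ... | no  small =
    let a , a<m , large = pigeonhole k m rest rest-bounded rest-long
    in  a , m<n⇒m<1+n a<m , <-≤-trans large (fibre-rest≤fibre a)
    where
      rest : List A
      rest = filter (¬? ∘ (λ x → col x ℕ.≟ m)) xs

      fibre-rest≤fibre : ∀ a → length (fibre a rest) ≤ length (fibre a xs)
      fibre-rest≤fibre a = length-mono-≤ (filter⁺ _ _ (λ { refl p → p }) (filter-⊆ _ xs))

      rest-bounded : All (λ x → col x < m) rest
      rest-bounded = All.map (λ (x<1+m , x≢m) → ≤∧≢⇒< (m<1+n⇒m≤n x<1+m) x≢m)
                             (All.zip (All.filter⁺ _ bounded , All.all-filter _ xs))

      rest-long : k * m < length rest
      rest-long = +-cancelˡ-< k (k * m) (length rest) (begin-strict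
        k + k * m                          ≡⟨ sym (*-suc k m) ⟩
        k * suc m                          <⟨ long ⟩
        length xs                          ≡⟨ length-filter+filter-¬ _ xs ⟩
        length (fibre m xs) + length rest  ≤⟨ +-monoˡ-≤ (length rest) (≮⇒≥ small) ⟩
        k + length rest                    ∎)
        where open ≤-Reasoning

module _ {n : ℕ} where

  _∈ₑ_ : Fin n → Fin n × Fin n → Set
  w ∈ₑ e = w ≡ proj₁ e ⊎ w ≡ proj₂ e

  _≈ₑ_ : Fin n × Fin n → Fin n × Fin n → Set
  e ≈ₑ e′ = (proj₁ e ≡ proj₁ e′ × proj₂ e ≡ proj₂ e′) ⊎ (proj₁ e ≡ proj₂ e′ × proj₂ e ≡ proj₁ e′)

  _≉ₑ_ : Fin n × Fin n → Fin n × Fin n → Set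
  e ≉ₑ e′ = ¬ e ≈ₑ e′

  ≈ₑ-sym : ∀ {e e′} → e ≈ₑ e′ → e′ ≈ₑ e
  ≈ₑ-sym (inj₁ (refl , refl)) = inj₁ (refl , refl)
  ≈ₑ-sym (inj₂ (refl , refl)) = inj₂ (refl , refl)

  ≈ₑ-trans : ∀ {e e′ e″} → e ≈ₑ e′ → e′ ≈ₑ e″ → e ≈ₑ e″
  ≈ₑ-trans (inj₁ (refl , refl)) s = s
  ≈ₑ-trans (inj₂ (refl , refl)) (inj₁ (refl , refl)) = inj₂ (refl , refl)
  ≈ₑ-trans (inj₂ (refl , refl)) (inj₂ (refl , refl)) = inj₁ (refl , refl)

  ≉ₑ-intro : ∀ {v x v′ y} → ¬ (v ≡ v′ × x ≡ y) → v ≢ y → (v , x) ≉ₑ (v′ , y)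
  ≉ₑ-intro different _   (inj₁ same)    = different same
  ≉ₑ-intro _         v≢y (inj₂ (v≡y , _)) = v≢y v≡y

  three-∉ₑ : ∀ {o₁ o₂ o₃ e} → o₁ ≢ o₂ → o₁ ≢ o₃ → o₂ ≢ o₃ → o₁ ∈ₑ e → o₂ ∈ₑ e → ¬ o₃ ∈ₑ e
  three-∉ₑ d₁₂ _   _   (inj₁ refl) (inj₁ refl) _           = d₁₂ refl
  three-∉ₑ d₁₂ _   _   (inj₂ refl) (inj₂ refl) _           = d₁₂ refl
  three-∉ₑ _   d₁₃ _   (inj₁ refl) (inj₂ refl) (inj₁ refl) = d₁₃ refl
  three-∉ₑ _   _   d₂₃ (inj₁ refl) (inj₂ refl) (inj₂ refl) = d₂₃ refl
  three-∉ₑ _   _   d₂₃ (inj₂ refl) (inj₁ refl) (inj₁ refl) = d₂₃ refl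
  three-∉ₑ _   d₁₃ _   (inj₂ refl) (inj₁ refl) (inj₂ refl) = d₁₃ refl

module _ {n m : ℕ} (c : Fin n → Fin n → Fin m) where

  SymmetricOffDiagonal : Set
  SymmetricOffDiagonal = ∀ u v → u ≢ v → c u v ≡ c v u

  Intersecting : Set
  Intersecting = ∀ a b x y → a ≢ b → x ≢ y → Disjoint a b x y → c a b ≢ c x y

  Star : Fin m → Fin n → Set
  Star a v = ∀ x y → x ≢ y → c x y ≡ a → v ∈ₑ (x , y)

module ColourClass {n m : ℕ} {c : Fin n → Fin n → Fin m}
                   (symmetric : SymmetricOffDiagonal c) (intersecting : Intersecting c) where

  _HasColour_ : Fin n × Fin n → Fin m → Set
  e HasColour a = proj₁ e ≢ proj₂ e × c (proj₁ e) (proj₂ e) ≡ a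

  meet : ∀ {a e e′} → e HasColour a → e′ HasColour a → proj₁ e ∈ₑ e′ ⊎ proj₂ e ∈ₑ e′
  meet {e = p , q} {x , y} (p≢q , cpq) (x≢y , cxy) with p ≟ x | p ≟ y | q ≟ x | q ≟ y
  ... | yes p≡x | _       | _       | _       = inj₁ (inj₁ p≡x)
  ... | no _    | yes p≡y | _       | _       = inj₁ (inj₂ p≡y)
  ... | no _    | no _    | yes q≡x | _       = inj₂ (inj₁ q≡x)
  ... | no _    | no _    | no _    | yes q≡y = inj₂ (inj₂ q≡y)
  ... | no p≢x  | no p≢y  | no q≢x  | no q≢y  =
    ⊥-elim (intersecting p q x y p≢q x≢y (p≢x , p≢y , q≢x , q≢y) (trans cpq (sym cxy)))

  neighbour-∈ₑ : ∀ {a w o e} → (w , o) HasColour a → e HasColour a →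
                 w ≢ proj₁ e → w ≢ proj₂ e → o ∈ₑ e
  neighbour-∈ₑ wo e w≢x w≢y with meet e wo
  ... | inj₁ (inj₁ x≡w) = ⊥-elim (w≢x (sym x≡w))
  ... | inj₁ (inj₂ x≡o) = inj₁ (sym x≡o)
  ... | inj₂ (inj₁ y≡w) = ⊥-elim (w≢y (sym y≡w))
  ... | inj₂ (inj₂ y≡o) = inj₂ (sym y≡o)

  star-of-three-neighbours : ∀ {a w o₁ o₂ o₃} →
    (w , o₁) HasColour a → (w , o₂) HasColour a → (w , o₃) HasColour a →
    o₁ ≢ o₂ → o₁ ≢ o₃ → o₂ ≢ o₃ → Star c a w
  star-of-three-neighbours {w = w} h₁ h₂ h₃ d₁₂ d₁₃ d₂₃ x y x≢y cxy with w ≟ x | w ≟ y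
  ... | yes w≡x | _       = inj₁ w≡x
  ... | no _    | yes w≡y = inj₂ w≡y
  ... | no w≢x  | no w≢y  =
    ⊥-elim (three-∉ₑ d₁₂ d₁₃ d₂₃ (neighbour h₁) (neighbour h₂) (neighbour h₃))
    where
      neighbour : ∀ {o} → (w , o) HasColour _ → o ∈ₑ (x , y)
      neighbour h = neighbour-∈ₑ h (x≢y , cxy) w≢x w≢y

  reorient-at : ∀ {a w e} → e HasColour a → w ∈ₑ e → ∃[ o ] (w , o) HasColour a × e ≈ₑ (w , o)
  reorient-at {e = x , y} h           (inj₁ refl) = y , h , inj₁ (refl , refl)
  reorient-at {e = x , y} (x≢y , cxy) (inj₂ refl) =
    x , (x≢y ∘ sym , trans (symmetric y x (x≢y ∘ sym)) cxy) , inj₂ (refl , refl)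

  star-of-three-edges : ∀ {a w e₁ e₂ e₃} → e₁ HasColour a → e₂ HasColour a → e₃ HasColour a →
    w ∈ₑ e₁ → w ∈ₑ e₂ → w ∈ₑ e₃ → e₁ ≉ₑ e₂ → e₁ ≉ₑ e₃ → e₂ ≉ₑ e₃ → Star c a w
  star-of-three-edges h₁ h₂ h₃ w₁ w₂ w₃ d₁₂ d₁₃ d₂₃
    with o₁ , k₁ , s₁ ← reorient-at h₁ w₁
       | o₂ , k₂ , s₂ ← reorient-at h₂ w₂
       | o₃ , k₃ , s₃ ← reorient-at h₃ w₃ =
    star-of-three-neighbours k₁ k₂ k₃
      (λ { refl → d₁₂ (≈ₑ-trans s₁ (≈ₑ-sym s₂)) })
      (λ { refl → d₁₃ (≈ₑ-trans s₁ (≈ₑ-sym s₃)) })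
      (λ { refl → d₂₃ (≈ₑ-trans s₂ (≈ₑ-sym s₃)) })

  star-of-large-class : ∀ {a} es → 3 < length es → AllPairs _≉ₑ_ es → All (_HasColour a) es →
                        ∃[ v ] Star c a v
  star-of-large-class (e₁ ∷ e₂ ∷ e₃ ∷ e₄ ∷ _) (s≤s (s≤s (s≤s (s≤s _))))
    ((d₁₂ ∷ d₁₃ ∷ d₁₄ ∷ _) ∷ (d₂₃ ∷ d₂₄ ∷ _) ∷ (d₃₄ ∷ _) ∷ _) (h₁ ∷ h₂ ∷ h₃ ∷ h₄ ∷ _)
    with meet h₁ h₂ | meet h₁ h₃ | meet h₁ h₄
  ... | inj₁ p₂ | inj₁ p₃ | _       = _ , star-of-three-edges h₁ h₂ h₃ (inj₁ refl) p₂ p₃ d₁₂ d₁₃ d₂₃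
  ... | inj₂ q₂ | inj₂ q₃ | _       = _ , star-of-three-edges h₁ h₂ h₃ (inj₂ refl) q₂ q₃ d₁₂ d₁₃ d₂₃
  ... | inj₁ p₂ | inj₂ _  | inj₁ p₄ = _ , star-of-three-edges h₁ h₂ h₄ (inj₁ refl) p₂ p₄ d₁₂ d₁₄ d₂₄
  ... | inj₁ _  | inj₂ q₃ | inj₂ q₄ = _ , star-of-three-edges h₁ h₃ h₄ (inj₂ refl) q₃ q₄ d₁₃ d₁₄ d₃₄
  ... | inj₂ _  | inj₁ p₃ | inj₁ p₄ = _ , star-of-three-edges h₁ h₃ h₄ (inj₁ refl) p₃ p₄ d₁₃ d₁₄ d₃₄
  ... | inj₂ q₂ | inj₁ _  | inj₂ q₄ = _ , star-of-three-edges h₁ h₂ h₄ (inj₂ refl) q₂ q₄ d₁₂ d₁₄ d₂₄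

module _ {n : ℕ} where

  fan : ∀ {k} → Fin n → (Fin k → Fin n) → List (Fin n × Fin n)
  fan v g = tabulate (λ w → v , g w)

  length-fan : ∀ {k} v (g : Fin k → Fin n) → length (fan v g) ≡ k
  length-fan v g = length-tabulate (λ w → v , g w)

  fan-proper : ∀ {k} v (g : Fin k → Fin n) → (∀ w → v ≢ g w) → All (λ e → proj₁ e ≢ proj₂ e) (fan v g)
  fan-proper _ _ v∉g = All.tabulate⁺ v∉g

  fan-distinct : ∀ {k} v (g : Fin k → Fin n) → (∀ w → v ≢ g w) → (∀ {i j} → g i ≡ g j → i ≡ j) →
                 AllPairs _≉ₑ_ (fan v g)
  fan-distinct _ _ v∉g g-injective =
    AllPairs.tabulate⁺ λ {i} {j} i≢j → ≉ₑ-intro (λ (_ , gi≡gj) → i≢j (g-injective gi≡gj)) (v∉g j)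

  fans-apart : ∀ {k l} v (f : Fin k → Fin n) v′ (g : Fin l → Fin n) → v ≢ v′ → (∀ w → v ≢ g w) →
               All (λ e → All (e ≉ₑ_) (fan v′ g)) (fan v f)
  fans-apart _ _ _ _ v≢v′ v∉g =
    All.tabulate⁺ λ _ → All.tabulate⁺ λ j → ≉ₑ-intro (λ (v≡v′ , _) → v≢v′ v≡v′) (v∉g j)

module _ {m : ℕ} where

  s¹ : Fin (2 + m) → Fin (3 + m)
  s¹ w = suc w

  s² : Fin (1 + m) → Fin (3 + m)
  s² w = suc (suc w)

  s³ : Fin m → Fin (3 + m)
  s³ w = suc (suc (suc w))

  edges-touching-012 : List (Fin (3 + m) × Fin (3 + m))
  edges-touching-012 = (fan zero s¹ ++ fan (suc zero) s²) ++ fan (suc (suc zero)) s³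

  length-edges-touching-012 : length edges-touching-012 ≡ 3 + 3 * m
  length-edges-touching-012 = begin
    length ((fan zero s¹ ++ fan (suc zero) s²) ++ fan (suc (suc zero)) s³)
      ≡⟨ length-++ (fan zero s¹ ++ fan (suc zero) s²) ⟩
    length (fan zero s¹ ++ fan (suc zero) s²) + length (fan (suc (suc zero)) s³)
      ≡⟨ cong (_+ length (fan (suc (suc zero)) s³)) (length-++ (fan zero s¹)) ⟩
    (length (fan zero s¹) + length (fan (suc zero) s²)) + length (fan (suc (suc zero)) s³)
      ≡⟨ cong₂ _+_ (cong₂ _+_ (length-fan zero s¹) (length-fan (suc zero) s²))
                   (length-fan (suc (suc zero)) s³) ⟩
    ((2 + m) + (1 + m)) + m
      ≡⟨ arithmetic m ⟩
    3 + 3 * m ∎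
    where
      open ≡-Reasoning
      arithmetic : ∀ m → ((2 + m) + (1 + m)) + m ≡ 3 + 3 * m
      arithmetic = solve-∀

  edges-touching-012-proper : All (λ e → proj₁ e ≢ proj₂ e) edges-touching-012
  edges-touching-012-proper =
    All.++⁺ (All.++⁺ (fan-proper zero s¹ λ _ ()) (fan-proper (suc zero) s² λ _ ()))
            (fan-proper (suc (suc zero)) s³ λ _ ())

  edges-touching-012-distinct : AllPairs _≉ₑ_ edges-touching-012
  edges-touching-012-distinct =
    AllPairs.++⁺
      (AllPairs.++⁺ (fan-distinct zero s¹ (λ _ ()) suc-injective)
                    (fan-distinct (suc zero) s² (λ _ ()) (suc-injective ∘ suc-injective))
                    (fans-apart zero s¹ (suc zero) s² (λ ()) (λ _ ())))
      (fan-distinct (suc (suc zero)) s³ (λ _ ()) (suc-injective ∘ suc-injective ∘ suc-injective))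
      (All.++⁺ (fans-apart zero s¹ (suc (suc zero)) s³ (λ ()) (λ _ ()))
               (fans-apart (suc zero) s² (suc (suc zero)) s³ (λ ()) (λ _ ())))

some-class-is-a-star : ∀ {m} {c : Fin (3 + m) → Fin (3 + m) → Fin m} →
                       SymmetricOffDiagonal c → Intersecting c → ∃₂ λ a v → Star c a v
some-class-is-a-star {m} {c} symmetric intersecting =
  let a , a<m , large = pigeonhole colourℕ 3 m edges-touching-012 bounded long
  in  fromℕ< a<m , star-of-large-class (fibre colourℕ a edges-touching-012) large
        (AllPairs.filter⁺ (has-colour? a) (edges-touching-012-distinct {m}))
        (All.map (λ (proper , colour≡a) → proper , toℕ-injective (trans colour≡a (sym (toℕ-fromℕ< a<m))))
                 (All.zip (All.filter⁺ (has-colour? a) (edges-touching-012-proper {m}) ,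
                           All.all-filter (has-colour? a) edges-touching-012)))
  where
    open ColourClass symmetric intersecting

    colourℕ : Fin (3 + m) × Fin (3 + m) → ℕ
    colourℕ (x , y) = toℕ (c x y)

    has-colour? : ∀ a → Decidable (λ e → colourℕ e ≡ a)
    has-colour? a e = colourℕ e ℕ.≟ a

    bounded : All (λ e → colourℕ e < m) edges-touching-012
    bounded = All.tabulate λ {e} _ → toℕ<n (c (proj₁ e) (proj₂ e))

    long : 3 * m < length (edges-touching-012 {m})
    long = subst (3 * m <_) (sym (length-edges-touching-012 {m})) (m<n+m (3 * m) {3} z<s)

module StarRemoval {n m : ℕ} {c : Fin (3 + n) → Fin (3 + n) → Fin (suc m)}
                   (symmetric : SymmetricOffDiagonal c) (intersecting : Intersecting c)
                   {a : Fin (suc m)} {v : Fin (3 + n)} (star : Star c a v) where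

  punchIn-injective′ : ∀ {i j} → i ≢ j → punchIn v i ≢ punchIn v j
  punchIn-injective′ {i} {j} i≢j = i≢j ∘ punchIn-injective v i j

  a≢colour : ∀ i j → i ≢ j → a ≢ c (punchIn v i) (punchIn v j)
  a≢colour i j i≢j a≡c with star _ _ (punchIn-injective′ i≢j) (sym a≡c)
  ... | inj₁ v≡i = punchInᵢ≢i v i (sym v≡i)
  ... | inj₂ v≡j = punchInᵢ≢i v j (sym v≡j)

  -- Outside v, colour a only occurs on the diagonal, where the value is irrelevant.
  recolour : Fin (suc m) → Fin m
  recolour x with a ≟ x
  ... | yes _   = punchOut (a≢colour zero (suc zero) (λ ()))
  ... | no  a≢x = punchOut a≢x

  recolour-≢ : ∀ {x} (a≢x : a ≢ x) → recolour x ≡ punchOut a≢x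
  recolour-≢ {x} a≢x with a ≟ x
  ... | yes a≡x = ⊥-elim (a≢x a≡x)
  ... | no  _   = punchOut-cong a refl

  removeStar : Fin (2 + n) → Fin (2 + n) → Fin m
  removeStar i j = recolour (c (punchIn v i) (punchIn v j))

  removeStar-symmetric : SymmetricOffDiagonal removeStar
  removeStar-symmetric i j i≢j = cong recolour (symmetric _ _ (punchIn-injective′ i≢j))

  removeStar-intersecting : Intersecting removeStar
  removeStar-intersecting p q x y p≢q x≢y (p≢x , p≢y , q≢x , q≢y) same =
    intersecting _ _ _ _ (punchIn-injective′ p≢q) (punchIn-injective′ x≢y)
      (punchIn-injective′ p≢x , punchIn-injective′ p≢y , punchIn-injective′ q≢x , punchIn-injective′ q≢y)
      (punchOut-injective (a≢colour p q p≢q) (a≢colour x y x≢y)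
        (trans (sym (recolour-≢ (a≢colour p q p≢q))) (trans same (recolour-≢ (a≢colour x y x≢y)))))

no-intersecting-colouring : ∀ m (c : Fin (3 + m) → Fin (3 + m) → Fin m) →
                            SymmetricOffDiagonal c → Intersecting c → ⊥
no-intersecting-colouring zero    c _         _            = ¬Fin0 (c zero (suc zero))
no-intersecting-colouring (suc m) c symmetric intersecting =
  let _ , _ , star = some-class-is-a-star symmetric intersecting
      open StarRemoval symmetric intersecting star
  in  no-intersecting-colouring m removeStar removeStar-symmetric removeStar-intersecting

independent-pair-or-complete : ∀ {n} (G : Graph n) → HasIndependentPair G ⊎ (∀ u v → u ≢ v → Edge G u v)
independent-pair-or-complete G with any? (λ u → any? (λ v → ¬? (u ≟ v) ×-dec ¬? (adj G u v Bool.≟ true)))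
... | yes pair = inj₁ pair
... | no  none =
  inj₂ λ u v u≢v → decidable-stable (adj G u v Bool.≟ true) λ ¬uv → none (u , v , u≢v , ¬uv)

lemma5p15 : (k : ℕ) (G : Graph (k + 3)) → HasCoColouring2 k G → HasIndependentPair G
lemma5p15 k G (col , co) with independent-pair-or-complete G
... | inj₁ pair     = pair
... | inj₂ complete =
  ⊥-elim (subst (λ n → (c : Fin n → Fin n → Fin k) → SymmetricOffDiagonal c → Intersecting c → ⊥)
                (+-comm 3 k) (no-intersecting-colouring k) (colour col) symmetric intersecting)
  where
    symmetric : SymmetricOffDiagonal (colour col)
    symmetric u v u≢v = colour-sym col u v (complete u v u≢v)

    intersecting : Intersecting (colour col)
    intersecting a b x y a≢b x≢y = co a b x y (complete a b a≢b) (complete x y x≢y)
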